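{- Let $n\ge1$ and let $\phi$ act on the set $\mathcal T_n$ of plane trees with $n$ edges. If $\phi$ has an orbit of length $l$, then either $l=2d$ for some positive divisor $d$ of $n$, or $n$ is odd and $l=n$.
   Context: A plane tree is a rooted tree whose children at each vertex are linearly ordered. For a plane tree with $n$ edges, label the $2n$ edge-sides $1,\dots,2n$ counterclockwise around the boundary starting from the root; each edge gets labels $i<j$ and is written $(i,j)$, so a tree is a noncrossing perfect matching of $[1,2n]$. The map $\phi$ on $\mathcal T_n$ is $\phi(T) = \{(k-1,2n) \mid (1,k) \in T\} \cup \{(i-1,j-1) \mid (i,j) \in T,\ 1 < i\}$ (rerooting one edge-side counterclockwise); it satisfies $\phi^{2n}=\mathrm{id}$. -}

module Defs where

open import Data.Nat using (ℕ; zero; suc; _+_; _*_; _∸_; _≤_; _<_)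
open import Data.Product using (_×_; _,_; ∃-syntax)
open import Data.List using (List; map)
open import Data.List.Membership.Propositional using (_∈_)
open import Relation.Binary.PropositionalEquality using (_≡_)
open import Function.Bundles using (_⇔_)
open import Data.Sum using (_⊎_)
open import Data.Empty using (⊥)

-- An edge (i , j) of a plane tree: a pair of edge-side labels with i < j.
Edge : Set
Edge = ℕ × ℕ

-- A tree is given by its (finite) set of edges, represented as a list;
-- lists are compared as sets (see _≈ᵀ_ below).
Tree : Set
Tree = List Edge

_occursIn_ : ℕ → Edge → Set
k occursIn (i , j) = (k ≡ i) ⊎ (k ≡ j)

-- T is a plane tree with n edges: a noncrossing perfect matching of [1,2n].
record IsPlaneTree (n : ℕ) (T : Tree) : Set where
  field
    inRange     : ∀ i j → (i , j) ∈ T → (1 ≤ i) × (i < j) × (j ≤ 2 * n)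
    covers      : ∀ k → 1 ≤ k → k ≤ 2 * n → ∃[ e ] (e ∈ T × k occursIn e)
    disjoint    : ∀ e f k → e ∈ T → f ∈ T → k occursIn e → k occursIn f → e ≡ f
    noncrossing : ∀ a b c d → (a , b) ∈ T → (c , d) ∈ T →
                  a < c → c < b → b < d → ⊥

_≈ᵀ_ : Tree → Tree → Set
T ≈ᵀ U = ∀ e → (e ∈ T) ⇔ (e ∈ U)

φEdge : ℕ → Edge → Edge
φEdge n (zero , j)        = (j ∸ 1 , 2 * n)   -- never occurs for trees (i ≥ 1)
φEdge n (suc zero , k)    = (k ∸ 1 , 2 * n)
φEdge n (suc (suc i) , j) = (suc i , j ∸ 1)

φ : ℕ → Tree → Tree
φ n T = map (φEdge n) T

φ^ : ℕ → ℕ → Tree → Tree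
φ^ n zero    T = T
φ^ n (suc l) T = φ n (φ^ n l T)

OrbitLength : ℕ → Tree → ℕ → Set
OrbitLength n T l =
  (1 ≤ l) × (φ^ n l T ≈ᵀ T) × (∀ m → 1 ≤ m → m < l → (φ^ n m T ≈ᵀ T → ⊥))

module Submission where

-- Since φ^(2n) is the identity, an orbit length l divides 2n: an even l = 2d gives d ∣ n,
-- and an odd l divides n, so it remains to rule out φ^l T = T with l odd and l < n.
-- Call the span of an edge the number of labels on the shorter of the two boundary arcs it
-- cuts off; it is invariant under φ and at most n.  Rotate T so that an edge of maximal span s
-- becomes (1 , 1+s); φ^l maps it to another edge of span s.  If l ≤ s the two edges cross.
-- If l > s, the labels after the image edge form a stretch of odd length l - s - 1 (s is odd
-- because every edge encloses an even number of labels).  An odd stretch cannot be matched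
-- within itself, and an edge leaving it has its other end between the two maximal edges, so
-- its span exceeds s.

open import Defs
open import Data.Nat
open import Data.Nat.Properties
open import Data.Nat.Divisibility using (_∣_; divides; m%n≡0⇒n∣m; *-cancelˡ-∣; ∣⇒≤)
open import Data.Nat.DivMod using (m≡m%n+[m/n]*n; m%n<n; [m+kn]%n≡m%n)
open import Data.Nat.Induction using (<-rec)
open import Data.Nat.Tactic.RingSolver using (solve-∀)
open import Data.Product using (_×_; _,_; ∃-syntax; proj₁; proj₂)
open import Data.Sum using (_⊎_; inj₁; inj₂)
open import Data.Empty using (⊥; ⊥-elim)
open import Data.List using (List; map; _∷_)
open import Data.List.Properties using (map-id; map-∘)
open import Data.List.Membership.Propositional using (_∈_)
open import Data.List.Membership.Propositional.Properties using (∈-map⁺; ∈-map⁻)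
open import Data.List.Relation.Unary.All as All using ()
open import Data.List.Relation.Unary.Any using (here; there)
open import Data.List.Relation.Binary.BagAndSetEquality using (map-cong)
open import Data.List.Extrema.Nat using (argmax; argmax-sel; f[⊥]≤f[argmax]; f[xs]≤f[argmax])
open import Function.Bundles using (_⇔_; mk⇔; Equivalence)
open import Function.Properties.Equivalence using (⇔-isEquivalence)
open import Relation.Binary.Bundles using (Setoid)
open import Relation.Binary.Structures using (IsEquivalence)
open import Relation.Binary.Definitions using (tri<; tri≈; tri>)
open import Relation.Binary.PropositionalEquality
import Relation.Binary.Reasoning.Setoid as ≈-Reasoning
open import Relation.Nullary using (yes; no)

∃-argmax : ∀ {A : Set} (f : A → ℕ) {x : A} {xs : List A} → x ∈ xs →
           ∃[ m ] (m ∈ xs × (∀ {y} → y ∈ xs → f y ≤ f m))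
∃-argmax f {xs = z ∷ zs} _ = argmax f z zs , argmax∈ , bounded
  where
  argmax∈ : argmax f z zs ∈ z ∷ zs
  argmax∈ with argmax-sel f z zs
  ... | inj₁ ≡z  = here ≡z
  ... | inj₂ ∈zs = there ∈zs
  bounded : ∀ {y} → y ∈ z ∷ zs → f y ≤ f (argmax f z zs)
  bounded (here refl) = f[⊥]≤f[argmax] {f = f} z zs
  bounded (there y∈) = All.lookup (f[xs]≤f[argmax] {f = f} z zs) y∈

-- Parity

Even Odd : ℕ → Set
Even m = ∃[ k ] (m ≡ 2 * k)
Odd  m = ∃[ k ] (m ≡ suc (2 * k))

suc-odd : ∀ {m} → Odd m → Even (suc m)
suc-odd (k , refl) = suc k , cong suc (sym (+-suc k (k + 0)))

even-or-odd : ∀ m → Even m ⊎ Odd m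
even-or-odd zero = inj₁ (0 , refl)
even-or-odd (suc m) with even-or-odd m
... | inj₁ (k , refl) = inj₂ (k , refl)
... | inj₂ odd-m      = inj₁ (suc-odd odd-m)

¬even∧odd : ∀ {m} → Even m → Odd m → ⊥
¬even∧odd (k , refl) (k′ , eq) = even≢odd k k′ eq

odd⇒>0 : ∀ {m} → Odd m → 0 < m
odd⇒>0 (_ , refl) = z<s

even-+ : ∀ {a b} → Even a → Even b → Even (a + b)
even-+ (x , refl) (y , refl) = x + y , sym (*-distribˡ-+ 2 x y)

odd-+-cancelˡ : ∀ {a b} → Even a → Odd (a + b) → Odd b
odd-+-cancelˡ {b = b} even-a odd-a+b with even-or-odd b
... | inj₁ even-b = ⊥-elim (¬even∧odd (even-+ even-a even-b) odd-a+b)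
... | inj₂ odd-b  = odd-b

odd-* : ∀ {a b} → Odd a → Odd b → Odd (a * b)
odd-* (c , refl) (d , refl) = c + d + 2 * c * d , expand c d
  where
  expand : ∀ c d → suc (2 * c) * suc (2 * d) ≡ suc (2 * (c + d + 2 * c * d))
  expand = solve-∀

odd-∣-2* : ∀ {l} n → Odd l → l ∣ 2 * n → l ∣ n
odd-∣-2* {l} n odd-l (divides q 2n≡ql) with even-or-odd q
... | inj₁ (c , refl) = divides c (*-cancelˡ-≡ n (c * l) 2 (trans 2n≡ql (*-assoc 2 c l)))
... | inj₂ odd-q      = ⊥-elim (¬even∧odd (n , refl) (subst Odd (sym 2n≡ql) (odd-* odd-q odd-l)))

odd⇒%2≡1 : ∀ {m} → Odd m → m % 2 ≡ 1
odd⇒%2≡1 (k , refl) = trans (cong (λ x → suc x % 2) (*-comm 2 k)) ([m+kn]%n≡m%n 1 k 2)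

-- Rotating a single edge

Valid : ℕ → Edge → Set
Valid n (i , j) = (1 ≤ i) × (i < j) × (j ≤ 2 * n)

edge-valid : ∀ {n T e} → IsPlaneTree n T → e ∈ T → Valid n e
edge-valid {e = i , j} P = IsPlaneTree.inRange P i j

φEdge^ : ℕ → ℕ → Edge → Edge
φEdge^ n zero    e = e
φEdge^ n (suc m) e = φEdge n (φEdge^ n m e)

φEdge^-+ : ∀ n a b e → φEdge^ n (a + b) e ≡ φEdge^ n a (φEdge^ n b e)
φEdge^-+ n zero    b e = refl
φEdge^-+ n (suc a) b e = cong (φEdge n) (φEdge^-+ n a b e)

φEdge^-comm : ∀ n a b e → φEdge^ n a (φEdge^ n b e) ≡ φEdge^ n b (φEdge^ n a e)
φEdge^-comm n a b e = begin
  φEdge^ n a (φEdge^ n b e)  ≡⟨ φEdge^-+ n a b e ⟨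
  φEdge^ n (a + b) e         ≡⟨ cong (λ k → φEdge^ n k e) (+-comm a b) ⟩
  φEdge^ n (b + a) e         ≡⟨ φEdge^-+ n b a e ⟩
  φEdge^ n b (φEdge^ n a e)  ∎
  where open ≡-Reasoning

φEdge^-suc : ∀ n k e → φEdge^ n (suc k) e ≡ φEdge^ n k (φEdge n e)
φEdge^-suc n zero    e = refl
φEdge^-suc n (suc k) e = cong (φEdge n) (φEdge^-suc n k e)

φEdge^-lower : ∀ n k i j → φEdge^ n k (k + suc i , k + j) ≡ (suc i , j)
φEdge^-lower n zero    i j = refl
φEdge^-lower n (suc k) i j = begin
  φEdge^ n (suc k) (suc (k + suc i) , suc (k + j))
    ≡⟨ cong (λ x → φEdge^ n (suc k) (suc x , suc (k + j))) (+-suc k i) ⟩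
  φEdge^ n (suc k) (suc (suc (k + i)) , suc (k + j))
    ≡⟨ φEdge^-suc n k _ ⟩
  φEdge^ n k (suc (k + i) , k + j)
    ≡⟨ cong (λ x → φEdge^ n k (x , k + j)) (+-suc k i) ⟨
  φEdge^ n k (k + suc i , k + j)
    ≡⟨ φEdge^-lower n k i j ⟩
  (suc i , j)
    ∎
  where open ≡-Reasoning

φEdge^-lower′ : ∀ n k {i j} i′ j′ → i ≡ k + suc i′ → j ≡ k + j′ →
                φEdge^ n k (i , j) ≡ (suc i′ , j′)
φEdge^-lower′ n k i′ j′ refl refl = φEdge^-lower n k i′ j′

φEdge^-to-root : ∀ n a b → φEdge^ n (suc a) (suc a , suc a + suc b) ≡ (suc b , 2 * n)
φEdge^-to-root n a b =
  cong (φEdge n) (φEdge^-lower′ n a 0 (suc (suc b)) (+-comm 1 a) (sym (+-suc a (suc b))))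

φEdge^-root-short : ∀ n k x y → 2 * n ≡ k + y → φEdge^ n (suc k) (1 , suc (suc k + x)) ≡ (suc x , y)
φEdge^-root-short n k x y 2n≡ = trans (φEdge^-suc n k _) (φEdge^-lower′ n k x y (sym (+-suc k x)) 2n≡)

φEdge^-root-long : ∀ n σ t a b → 2 * n ≡ t + b → b ≡ suc σ + suc a →
                   φEdge^ n (t + suc (suc σ)) (1 , suc (suc σ)) ≡ (suc a , b)
φEdge^-root-long n σ t a b 2n≡ b≡ = begin
  φEdge^ n (t + suc (suc σ)) (1 , suc (suc σ))
    ≡⟨ φEdge^-+ n t (suc (suc σ)) _ ⟩
  φEdge^ n t (φEdge^ n (suc (suc σ)) (1 , suc (suc σ)))
    ≡⟨ cong (φEdge^ n t) (φEdge^-suc n (suc σ) _) ⟩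
  φEdge^ n t (φEdge^ n (suc σ) (suc σ , 2 * n))
    ≡⟨ cong (λ x → φEdge^ n t (φEdge^ n (suc σ) (suc σ , x))) 2n≡′ ⟩
  φEdge^ n t (φEdge^ n (suc σ) (suc σ , suc σ + suc (t + a)))
    ≡⟨ cong (φEdge^ n t) (φEdge^-to-root n σ (t + a)) ⟩
  φEdge^ n t (suc (t + a) , 2 * n)
    ≡⟨ φEdge^-lower′ n t a b (sym (+-suc t a)) 2n≡ ⟩
  (suc a , b)
    ∎
  where
  open ≡-Reasoning
  reorder : ∀ t σ a → t + (suc σ + suc a) ≡ suc σ + suc (t + a)
  reorder = solve-∀
  2n≡′ : 2 * n ≡ suc σ + suc (t + a)
  2n≡′ = trans 2n≡ (trans (cong (t +_) b≡) (reorder t σ a))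

-- a, b and c labels lie before, strictly inside and after the edge
data Arcs (n : ℕ) : Edge → Set where
  arcs : ∀ a b c → suc a + suc b + c ≡ 2 * n → Arcs n (suc a , suc a + suc b)

arcs-of-valid : ∀ n {e} → Valid n e → Arcs n e
arcs-of-valid n {suc a , j} (_ , a<j , j≤2n) with m≤n⇒∃[o]m+o≡n a<j | m≤n⇒∃[o]m+o≡n j≤2n
... | b , refl | c , eq =
  subst (λ j → Arcs n (suc a , j)) (+-suc (suc a) b)
    (arcs a b c (trans (cong (_+ c) (+-suc (suc a) b)) eq))

φEdge^-2n : ∀ n {e} → Valid n e → φEdge^ n (2 * n) e ≡ e
φEdge^-2n n v with arcs-of-valid n v
... | arcs a b c eq = begin
  φEdge^ n (2 * n) e
    ≡⟨ cong (λ k → φEdge^ n k e) (trans (sym eq) (reorder₁ a b c)) ⟩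
  φEdge^ n (c + (suc b + suc a)) e
    ≡⟨ trans (φEdge^-+ n c _ e) (cong (φEdge^ n c) (φEdge^-+ n (suc b) (suc a) e)) ⟩
  φEdge^ n c (φEdge^ n (suc b) (φEdge^ n (suc a) e))
    ≡⟨ cong (λ x → φEdge^ n c (φEdge^ n (suc b) x)) (φEdge^-to-root n a b) ⟩
  φEdge^ n c (φEdge^ n (suc b) (suc b , 2 * n))
    ≡⟨ cong (λ x → φEdge^ n c (φEdge^ n (suc b) (suc b , x))) (trans (sym eq) (reorder₂ a b c)) ⟩
  φEdge^ n c (φEdge^ n (suc b) (suc b , suc b + suc (a + c)))
    ≡⟨ cong (φEdge^ n c) (φEdge^-to-root n b (a + c)) ⟩
  φEdge^ n c (suc (a + c) , 2 * n)
    ≡⟨ φEdge^-lower′ n c a (suc a + suc b) (reorder₃ a c) (trans (sym eq) (+-comm _ c)) ⟩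
  e
    ∎
  where
  open ≡-Reasoning
  e : Edge
  e = (suc a , suc a + suc b)
  reorder₁ : ∀ a b c → suc a + suc b + c ≡ c + (suc b + suc a)
  reorder₁ = solve-∀
  reorder₂ : ∀ a b c → suc a + suc b + c ≡ suc b + suc (a + c)
  reorder₂ = solve-∀
  reorder₃ : ∀ a c → suc (a + c) ≡ c + suc a
  reorder₃ = solve-∀

-- Orbits of trees

φ^≡map : ∀ n m T → φ^ n m T ≡ map (φEdge^ n m) T
φ^≡map n zero    T = sym (map-id T)
φ^≡map n (suc m) T = trans (cong (φ n) (φ^≡map n m T)) (sym (map-∘ T))

φ^-+ : ∀ n a b T → φ^ n (a + b) T ≡ φ^ n a (φ^ n b T)
φ^-+ n zero    b T = refl
φ^-+ n (suc a) b T = cong (φ n) (φ^-+ n a b T)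

∈-φ^⁺ : ∀ n m {T e} → e ∈ T → φEdge^ n m e ∈ φ^ n m T
∈-φ^⁺ n m {T} e∈T = subst (_ ∈_) (sym (φ^≡map n m T)) (∈-map⁺ (φEdge^ n m) e∈T)

∈-φ^⁻ : ∀ n m {T e} → e ∈ φ^ n m T → ∃[ e₀ ] (e₀ ∈ T × e ≡ φEdge^ n m e₀)
∈-φ^⁻ n m {T} e∈ = ∈-map⁻ (φEdge^ n m) (subst (_ ∈_) (φ^≡map n m T) e∈)

≈ᵀ-setoid : Setoid _ _
≈ᵀ-setoid = record
  { Carrier       = Tree
  ; _≈_           = _≈ᵀ_
  ; isEquivalence = record
    { refl  = λ e → ⇔.refl
    ; sym   = λ p e → ⇔.sym (p e)
    ; trans = λ p q e → ⇔.trans (p e) (q e)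
    }
  }
  where module ⇔ = IsEquivalence ⇔-isEquivalence

open Setoid ≈ᵀ-setoid using () renaming (refl to ≈ᵀ-refl; sym to ≈ᵀ-sym)

φ^-cong : ∀ n m {T U} → T ≈ᵀ U → φ^ n m T ≈ᵀ φ^ n m U
φ^-cong n m {T} {U} T≈U e =
  subst₂ (λ T′ U′ → (e ∈ T′) ⇔ (e ∈ U′)) (sym (φ^≡map n m T)) (sym (φ^≡map n m U))
    (map-cong (λ _ → refl) (λ {x} → T≈U x) {e})

φ^-fixed⇒closed : ∀ n l {T e} → φ^ n l T ≈ᵀ T → e ∈ T → φEdge^ n l e ∈ T
φ^-fixed⇒closed n l fix e∈T = Equivalence.to (fix _) (∈-φ^⁺ n l e∈T)

φ^-2n : ∀ n {T} → IsPlaneTree n T → φ^ n (2 * n) T ≈ᵀ T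
φ^-2n n {T} P e = mk⇔ from-φ^ to-φ^
  where
  from-φ^ : e ∈ φ^ n (2 * n) T → e ∈ T
  from-φ^ e∈ with ∈-φ^⁻ n (2 * n) e∈
  ... | e₀ , e₀∈T , refl = subst (_∈ T) (sym (φEdge^-2n n (edge-valid P e₀∈T))) e₀∈T
  to-φ^ : e ∈ T → e ∈ φ^ n (2 * n) T
  to-φ^ e∈T = subst (_∈ φ^ n (2 * n) T) (φEdge^-2n n (edge-valid P e∈T)) (∈-φ^⁺ n (2 * n) e∈T)

φ^-fixed-* : ∀ n l {T} → φ^ n l T ≈ᵀ T → ∀ q → φ^ n (q * l) T ≈ᵀ T
φ^-fixed-* n l     fix zero    = ≈ᵀ-refl
φ^-fixed-* n l {T} fix (suc q) = begin
  φ^ n (l + q * l) T       ≡⟨ φ^-+ n l (q * l) T ⟩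
  φ^ n l (φ^ n (q * l) T)  ≈⟨ φ^-cong n l (φ^-fixed-* n l fix q) ⟩
  φ^ n l T                 ≈⟨ fix ⟩
  T                        ∎
  where open ≈-Reasoning ≈ᵀ-setoid

φ^-fixed-% : ∀ n N l .{{_ : NonZero l}} {T} → φ^ n N T ≈ᵀ T → φ^ n l T ≈ᵀ T →
             φ^ n (N % l) T ≈ᵀ T
φ^-fixed-% n N l {T} fixN fixl = ≈ᵀ-sym (begin
  T                                  ≈⟨ fixN ⟨
  φ^ n N T                           ≡⟨ cong (λ k → φ^ n k T) (m≡m%n+[m/n]*n N l) ⟩
  φ^ n (N % l + N / l * l) T         ≡⟨ φ^-+ n (N % l) (N / l * l) T ⟩
  φ^ n (N % l) (φ^ n (N / l * l) T)  ≈⟨ φ^-cong n (N % l) (φ^-fixed-* n l fixl (N / l)) ⟩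
  φ^ n (N % l) T                     ∎)
  where open ≈-Reasoning ≈ᵀ-setoid

orbitLength-∣ : ∀ n {T l} N → OrbitLength n T l → φ^ n N T ≈ᵀ T → l ∣ N
orbitLength-∣ n {T} {suc l′} N (_ , fixl , minimal) fixN with N % suc l′ in N%l≡
... | zero  = m%n≡0⇒n∣m N (suc l′) N%l≡
... | suc r = ⊥-elim (minimal (suc r) (s≤s z≤n) (subst (_< suc l′) N%l≡ (m%n<n N (suc l′)))
                (subst (λ k → φ^ n k T ≈ᵀ T) N%l≡ (φ^-fixed-% n N (suc l′) fixN fixl)))

-- φ maps plane trees to plane trees

data EdgeView : Edge → Set where
  starts-at-1  : ∀ j → EdgeView (1 , suc (suc j))
  starts-later : ∀ i j → EdgeView (suc (suc i) , suc j)

edge-view : ∀ n {e} → Valid n e → EdgeView e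
edge-view n {suc zero    , suc (suc j)} _                 = starts-at-1 j
edge-view n {suc zero    , suc zero}    (_ , s≤s () , _)
edge-view n {suc (suc i) , suc j}       _                 = starts-later i j
edge-view n {suc (suc i) , zero}        (_ , () , _)

valid-φEdge : ∀ n {e} → Valid n e → Valid n (φEdge n e)
valid-φEdge n v with edge-view n v
valid-φEdge n (_ , _ , j+2≤2n)       | starts-at-1 j    = s≤s z≤n , j+2≤2n , ≤-refl
valid-φEdge n (_ , s≤s i<j , j+1≤2n) | starts-later i j = s≤s z≤n , i<j , ≤-trans (n≤1+n j) j+1≤2n

valid-φEdge^ : ∀ n m {e} → Valid n e → Valid n (φEdge^ n m e)
valid-φEdge^ n zero    v = v
valid-φEdge^ n (suc m) v = valid-φEdge n (valid-φEdge^ n m v)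

occursIn-φEdge⁺ : ∀ n {e k} → Valid n e → 1 ≤ k → suc k occursIn e → k occursIn φEdge n e
occursIn-φEdge⁺ n v 1≤k k+1∈e with edge-view n v
occursIn-φEdge⁺ n v ()  (inj₁ refl) | starts-at-1 j
occursIn-φEdge⁺ n v 1≤k (inj₂ refl) | starts-at-1 j    = inj₁ refl
occursIn-φEdge⁺ n v 1≤k (inj₁ refl) | starts-later i j = inj₁ refl
occursIn-φEdge⁺ n v 1≤k (inj₂ refl) | starts-later i j = inj₂ refl

occursIn-φEdge-1 : ∀ n {e} → Valid n e → 1 occursIn e → (2 * n) occursIn φEdge n e
occursIn-φEdge-1 n v 1∈e with edge-view n v
occursIn-φEdge-1 n v                (inj₁ refl) | starts-at-1 j      = inj₂ refl
occursIn-φEdge-1 n (_ , s≤s () , _) (inj₂ refl) | starts-later i zero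

occursIn-φEdge⁻ : ∀ n {e k} → Valid n e → k occursIn φEdge n e →
                  (k ≡ 2 * n × 1 occursIn e) ⊎ (k < 2 * n × suc k occursIn e)
occursIn-φEdge⁻ n v k∈ with edge-view n v
occursIn-φEdge⁻ n (_ , _ , j+2≤2n)       (inj₁ refl) | starts-at-1 j
  = inj₂ (j+2≤2n , inj₂ refl)
occursIn-φEdge⁻ n _                      (inj₂ refl) | starts-at-1 j
  = inj₁ (refl , inj₁ refl)
occursIn-φEdge⁻ n (_ , s≤s i<j , j+1≤2n) (inj₁ refl) | starts-later i j
  = inj₂ (<-≤-trans i<j (≤-trans (n≤1+n j) j+1≤2n) , inj₁ refl)
occursIn-φEdge⁻ n (_ , _ , j+1≤2n)       (inj₂ refl) | starts-later i j
  = inj₂ (j+1≤2n , inj₂ refl)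

φ-preserves-IsPlaneTree : ∀ n {T} → IsPlaneTree n T → IsPlaneTree n (φ n T)
φ-preserves-IsPlaneTree n {T} P = record
  { inRange     = inRange′
  ; covers      = covers′
  ; disjoint    = disjoint′
  ; noncrossing = noncrossing′
  }
  where
  open IsPlaneTree P

  inRange′ : ∀ i j → (i , j) ∈ φ n T → Valid n (i , j)
  inRange′ i j e∈ with ∈-map⁻ (φEdge n) e∈
  ... | e₀ , e₀∈T , refl = valid-φEdge n (edge-valid P e₀∈T)

  covers′ : ∀ k → 1 ≤ k → k ≤ 2 * n → ∃[ e ] (e ∈ φ n T × k occursIn e)
  covers′ k 1≤k k≤2n with m≤n⇒m<n∨m≡n k≤2n
  ... | inj₁ k<2n with covers (suc k) (s≤s z≤n) k<2n
  ...   | e , e∈T , k+1∈e =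
    φEdge n e , ∈-map⁺ (φEdge n) e∈T , occursIn-φEdge⁺ n (edge-valid P e∈T) 1≤k k+1∈e
  covers′ k 1≤k k≤2n | inj₂ refl with covers 1 ≤-refl (≤-trans 1≤k k≤2n)
  ...   | e , e∈T , 1∈e =
    φEdge n e , ∈-map⁺ (φEdge n) e∈T , occursIn-φEdge-1 n (edge-valid P e∈T) 1∈e

  disjoint′ : ∀ e f k → e ∈ φ n T → f ∈ φ n T → k occursIn e → k occursIn f → e ≡ f
  disjoint′ _ _ k e∈ f∈ k∈e k∈f with ∈-map⁻ (φEdge n) e∈ | ∈-map⁻ (φEdge n) f∈
  ... | e , e∈T , refl | f , f∈T , refl
    with occursIn-φEdge⁻ n (edge-valid P e∈T) k∈e | occursIn-φEdge⁻ n (edge-valid P f∈T) k∈f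
  ... | inj₁ (_ , 1∈e)   | inj₁ (_ , 1∈f)   = cong (φEdge n) (disjoint e f 1 e∈T f∈T 1∈e 1∈f)
  ... | inj₂ (_ , k+1∈e) | inj₂ (_ , k+1∈f) =
    cong (φEdge n) (disjoint e f (suc k) e∈T f∈T k+1∈e k+1∈f)
  ... | inj₁ (refl , _)  | inj₂ (k<2n , _)  = ⊥-elim (<-irrefl refl k<2n)
  ... | inj₂ (k<2n , _)  | inj₁ (refl , _)  = ⊥-elim (<-irrefl refl k<2n)

  noncrossing′ : ∀ a b c d → (a , b) ∈ φ n T → (c , d) ∈ φ n T → a < c → c < b → b < d → ⊥
  noncrossing′ a b c d ab∈ cd∈ a<c c<b b<d with ∈-map⁻ (φEdge n) ab∈ | ∈-map⁻ (φEdge n) cd∈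
  ... | e , e∈T , e↦ab | f , f∈T , f↦cd
    with edge-view n (edge-valid P e∈T) | edge-view n (edge-valid P f∈T) | e↦ab | f↦cd
  ... | starts-at-1 _    | _                | refl | _    =
    <⇒≱ b<d (proj₂ (proj₂ (inRange′ c d cd∈)))
  ... | starts-later _ _ | starts-at-1 _    | refl | refl =
    noncrossing _ _ _ _ f∈T e∈T (s≤s (s≤s z≤n)) (s≤s a<c) (s≤s c<b)
  ... | starts-later _ _ | starts-later _ _ | refl | refl =
    noncrossing _ _ _ _ e∈T f∈T (s≤s a<c) (s≤s c<b) (s≤s b<d)

φ^-preserves-IsPlaneTree : ∀ n m {T} → IsPlaneTree n T → IsPlaneTree n (φ^ n m T)
φ^-preserves-IsPlaneTree n zero    P = P
φ^-preserves-IsPlaneTree n (suc m) P = φ-preserves-IsPlaneTree n (φ^-preserves-IsPlaneTree n m P)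

-- The span of an edge

span : ℕ → Edge → ℕ
span n (i , j) = (j ∸ i) ⊓ (2 * n ∸ (j ∸ i))

span-φEdge : ∀ n {e} → Valid n e → span n (φEdge n e) ≡ span n e
span-φEdge n v with edge-view n v
span-φEdge n (_ , _ , j+2≤2n) | starts-at-1 j =
  trans (cong ((2 * n ∸ suc j) ⊓_) (m∸[m∸n]≡n (<⇒≤ j+2≤2n))) (⊓-comm (2 * n ∸ suc j) (suc j))
span-φEdge n _ | starts-later i j = refl

span-φEdge^ : ∀ n m {e} → Valid n e → span n (φEdge^ n m e) ≡ span n e
span-φEdge^ n zero    v = refl
span-φEdge^ n (suc m) v = trans (span-φEdge n (valid-φEdge^ n m v)) (span-φEdge^ n m v)

m⊓[2n∸m]≤n : ∀ m n → m ⊓ (2 * n ∸ m) ≤ n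
m⊓[2n∸m]≤n m n with ≤-total m n
... | inj₁ m≤n = ≤-trans (m⊓n≤m m _) m≤n
... | inj₂ n≤m = ≤-trans (m⊓n≤n m _) (≤-trans (∸-monoʳ-≤ (2 * n) n≤m) (≤-reflexive 2n∸n≡n))
  where
  2n∸n≡n : 2 * n ∸ n ≡ n
  2n∸n≡n = trans (m+n∸m≡n n (n + 0)) (+-identityʳ n)

span-≤ : ∀ n e → span n e ≤ n
span-≤ n (i , j) = m⊓[2n∸m]≤n (j ∸ i) n

<span : ∀ n s {u v} → u ≤ v → s + u < v → s + v < 2 * n + u → s < span n (u , v)
<span n s {u} {v} u≤v s+u<v s+v<2n+u =
  ⊓-glb (m+n≤o⇒m≤o∸n (suc s) s+u<v) (m+n≤o⇒m≤o∸n (suc s) outside)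
  where
  s+[v∸u]+u≡s+v : suc s + (v ∸ u) + u ≡ suc s + v
  s+[v∸u]+u≡s+v = trans (+-assoc (suc s) (v ∸ u) u) (cong (suc s +_) (m∸n+n≡m u≤v))
  outside : suc s + (v ∸ u) ≤ 2 * n
  outside = +-cancelʳ-≤ u _ _ (subst (_≤ 2 * n + u) (sym s+[v∸u]+u≡s+v) s+v<2n+u)

span-arcs : ∀ n a b c → suc a + suc b + c ≡ 2 * n →
            span n (suc a , suc a + suc b) ≡ suc b ⊓ (suc a + c)
span-arcs n a b c eq = cong₂ _⊓_ inside (trans (cong (2 * n ∸_) inside) outside)
  where
  reorder : ∀ a b c → suc a + suc b + c ≡ suc b + (suc a + c)
  reorder = solve-∀
  inside : suc a + suc b ∸ suc a ≡ suc b
  inside = m+n∸m≡n (suc a) (suc b)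
  outside : 2 * n ∸ suc b ≡ suc a + c
  outside = trans (cong (_∸ suc b) (trans (sym eq) (reorder a b c))) (m+n∸m≡n (suc b) (suc a + c))

rotate-to-root : ∀ n {e} → Valid n e → ∃[ r ] (φEdge^ n r e ≡ (1 , suc (span n e)))
rotate-to-root n v with arcs-of-valid n v
... | arcs a b c eq with ≤-total (suc b) (suc a + c)
...   | inj₁ b≤a+c = a , (begin
  φEdge^ n a e
    ≡⟨ φEdge^-lower′ n a 0 (suc (suc b)) (+-comm 1 a) (sym (+-suc a (suc b))) ⟩
  (1 , suc (suc b))
    ≡⟨ cong (λ x → (1 , suc x)) (trans (span-arcs n a b c eq) (m≤n⇒m⊓n≡m b≤a+c)) ⟨
  (1 , suc (span n e))
    ∎)
  where
  open ≡-Reasoning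
  e : Edge
  e = (suc a , suc a + suc b)
...   | inj₂ a+c≤b = b + suc a , (begin
  φEdge^ n (b + suc a) e
    ≡⟨ φEdge^-+ n b (suc a) e ⟩
  φEdge^ n b (φEdge^ n (suc a) e)
    ≡⟨ cong (φEdge^ n b) (φEdge^-to-root n a b) ⟩
  φEdge^ n b (suc b , 2 * n)
    ≡⟨ φEdge^-lower′ n b 0 (suc (suc a + c)) (+-comm 1 b) (trans (sym eq) (reorder a b c)) ⟩
  (1 , suc (suc a + c))
    ≡⟨ cong (λ x → (1 , suc x)) (trans (span-arcs n a b c eq) (m≥n⇒m⊓n≡n a+c≤b)) ⟨
  (1 , suc (span n e))
    ∎)
  where
  open ≡-Reasoning
  e : Edge
  e = (suc a , suc a + suc b)
  reorder : ∀ a b c → suc a + suc b + c ≡ b + suc (suc a + c)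
  reorder = solve-∀

-- Noncrossing matchings

Straddles : ℕ → ℕ → Edge → Set
Straddles p q (u , v) = (p ≤ u × u < q × q ≤ v) ⊎ (u < p × p ≤ v × v < q)

module _ {n U} (P : IsPlaneTree n U) where
  open IsPlaneTree P

  1≤start : ∀ {i j} → (i , j) ∈ U → 1 ≤ i
  1≤start {i} {j} e∈ = proj₁ (inRange i j e∈)

  start<end : ∀ {i j} → (i , j) ∈ U → i < j
  start<end {i} {j} e∈ = proj₁ (proj₂ (inRange i j e∈))

  end≤2n : ∀ {i j} → (i , j) ∈ U → j ≤ 2 * n
  end≤2n {i} {j} e∈ = proj₂ (proj₂ (inRange i j e∈))

  starts-outside : ∀ {i j u v} → (i , j) ∈ U → (u , v) ∈ U → j < v → u < i ⊎ j < u
  starts-outside {i} {j} {u} {v} ij∈ uv∈ j<v with <-cmp u i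
  ... | tri< u<i _ _  = inj₁ u<i
  ... | tri≈ _ refl _ =
    ⊥-elim (<-irrefl (cong proj₂ (disjoint _ _ u ij∈ uv∈ (inj₁ refl) (inj₁ refl))) j<v)
  ... | tri> _ _ i<u with <-cmp u j
  ...   | tri< u<j _ _  = ⊥-elim (noncrossing i j u v ij∈ uv∈ i<u u<j j<v)
  ...   | tri≈ _ refl _ =
    ⊥-elim (<-irrefl (cong proj₂ (disjoint _ _ u ij∈ uv∈ (inj₂ refl) (inj₁ refl))) j<v)
  ...   | tri> _ _ j<u  = inj₂ j<u

  ¬straddles-inside : ∀ {i j u v} → (i , j) ∈ U → (u , v) ∈ U → Straddles (suc i) j (u , v) → ⊥
  ¬straddles-inside {j = j} ij∈ uv∈ (inj₁ (i<u , u<j , j≤v)) with m≤n⇒m<n∨m≡n j≤v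
  ... | inj₂ refl = <-irrefl (cong proj₁ (disjoint _ _ j ij∈ uv∈ (inj₂ refl) (inj₂ refl))) i<u
  ... | inj₁ j<v with starts-outside ij∈ uv∈ j<v
  ...   | inj₁ u<i = <-asym i<u u<i
  ...   | inj₂ j<u = <-asym u<j j<u
  ¬straddles-inside ij∈ uv∈ (inj₂ (u≤i , i<v , v<j)) with starts-outside uv∈ ij∈ v<j
  ... | inj₁ i<u = <⇒≱ i<u (s≤s⁻¹ u≤i)
  ... | inj₂ v<i = <-asym i<v v<i

  straddles-beyond : ∀ {p j q u v} → (p , j) ∈ U → (u , v) ∈ U →
                     Straddles (suc j) q (u , v) → Straddles p q (u , v)
  straddles-beyond {p} {j} pj∈ uv∈ (inj₁ (j<u , u<q , q≤v)) =
    inj₁ (<⇒≤ (<-trans (start<end pj∈) j<u) , u<q , q≤v)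
  straddles-beyond {p} {j} pj∈ uv∈ (inj₂ (u≤j , j<v , v<q)) with starts-outside pj∈ uv∈ j<v
  ... | inj₁ u<p = inj₂ (u<p , <⇒≤ (<-trans (start<end pj∈) j<v) , v<q)
  ... | inj₂ j<u = ⊥-elim (<⇒≱ j<u (s≤s⁻¹ u≤j))

  -- The edge at p leaves [p , q) or ends at some j < q.  By induction it encloses an even
  -- number of labels, so [j+1 , q) is a shorter interval of odd length, and an edge leaving
  -- it leaves [p , q).
  odd-interval-straddled : ∀ m {p} → Odd m → 1 ≤ p → p + m ≤ suc (2 * n) →
                           ∃[ e ] (e ∈ U × Straddles p (p + m) e)
  odd-interval-straddled = <-rec OddIntervalStraddled step
    where
    OddIntervalStraddled : ℕ → Set
    OddIntervalStraddled m =
      ∀ {p} → Odd m → 1 ≤ p → p + m ≤ suc (2 * n) → ∃[ e ] (e ∈ U × Straddles p (p + m) e)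

    step : ∀ m → (∀ {m′} → m′ < m → OddIntervalStraddled m′) → OddIntervalStraddled m
    step m rec {p} odd-m 1≤p p+m≤ =
      let e , e∈ , p∈e = covers p 1≤p (s≤s⁻¹ (<-≤-trans p<p+m p+m≤)) in from-edge e∈ p∈e
      where
      p<p+m : p < p + m
      p<p+m = m<m+n p (odd⇒>0 odd-m)

      from-inner-edge : ∀ {j} → (p , j) ∈ U → j < p + m → ∃[ e ] (e ∈ U × Straddles p (p + m) e)
      from-inner-edge pj∈ j<q with m≤n⇒∃[o]m+o≡n (start<end pj∈) | m≤n⇒∃[o]m+o≡n j<q
      ... | a , refl | m′ , eq =
        let (u , v) , uv∈ , str = rec m′<m odd-m′ (s≤s z≤n) (subst (_≤ suc (2 * n)) (sym eq) p+m≤)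
        in (u , v) , uv∈ ,
           straddles-beyond pj∈ uv∈ (subst (λ q → Straddles (suc (suc p + a)) q (u , v)) eq str)
        where
        a<m : a < m
        a<m = <-trans (n<1+n a) (+-cancelˡ-< p (suc a) m (subst (_< p + m) (sym (+-suc p a)) j<q))
        enclosed-even : Even a
        enclosed-even with even-or-odd a
        ... | inj₁ even-a = even-a
        ... | inj₂ odd-a  =
          let _ , uv∈ , str = rec a<m odd-a (s≤s z≤n) (≤-trans (end≤2n pj∈) (n≤1+n _))
          in ⊥-elim (¬straddles-inside pj∈ uv∈ str)
        reorder : ∀ p a m′ → suc (suc p + a) + m′ ≡ p + ((2 + a) + m′)
        reorder = solve-∀
        m≡ : m ≡ (2 + a) + m′
        m≡ = +-cancelˡ-≡ p m _ (trans (sym eq) (reorder p a m′))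
        m′<m : m′ < m
        m′<m = subst (m′ <_) (sym m≡) (m<n+m m′ z<s)
        odd-m′ : Odd m′
        odd-m′ = odd-+-cancelˡ (even-+ (1 , refl) enclosed-even) (subst Odd m≡ odd-m)

      from-edge : ∀ {e} → e ∈ U → p occursIn e → ∃[ e ] (e ∈ U × Straddles p (p + m) e)
      from-edge {i , _} ip∈ (inj₂ refl) = (i , p) , ip∈ , inj₂ (start<end ip∈ , ≤-refl , p<p+m)
      from-edge {_ , j} pj∈ (inj₁ refl) with p + m ≤? j
      ... | yes q≤j = (p , j) , pj∈ , inj₁ (≤-refl , p<p+m , q≤j)
      ... | no  q≰j = from-inner-edge pj∈ (≰⇒> q≰j)

  edge-length-odd : ∀ {i d} → (i , i + d) ∈ U → Odd d
  edge-length-odd {i} {d} e∈ with even-or-odd d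
  ... | inj₂ odd-d = odd-d
  ... | inj₁ (zero , refl) = ⊥-elim (<-irrefl (sym (+-identityʳ i)) (start<end e∈))
  ... | inj₁ (suc c , refl) =
    let (u , v) , uv∈ , str = odd-interval-straddled (suc (2 * c)) (c , refl) (s≤s z≤n) inside-bound
    in ⊥-elim (¬straddles-inside e∈ uv∈ (subst (λ q → Straddles (suc i) q (u , v)) (sym (reorder i c)) str))
    where
    reorder : ∀ i c → i + 2 * suc c ≡ suc i + suc (2 * c)
    reorder = solve-∀
    inside-bound : suc i + suc (2 * c) ≤ suc (2 * n)
    inside-bound = subst (_≤ suc (2 * n)) (reorder i c) (≤-trans (end≤2n e∈) (n≤1+n _))

  -- Rotating the root edge (1 , 1+s) by l ≤ s gives (1+s-l , 2n+1-l), which crosses it or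
  -- (when l = s) shares the label 1 with it.
  short-rotation : ∀ {l s} → 1 ≤ l → l ≤ s → l + s < 2 * n →
                   (1 , suc s) ∈ U → φEdge^ n l (1 , suc s) ∈ U → ⊥
  short-rotation {suc l′} _ l≤s l+s<2n root∈ image∈ with m≤n⇒∃[o]m+o≡n l≤s
  ... | x , refl
    with m≤n⇒∃[o]m+o≡n (≤-trans (n≤1+n l′) (m+n≤o⇒m≤o (suc l′) (<⇒≤ l+s<2n)))
  ...   | y , 2n≡ with starts-outside root∈ image∈′ s+1<y
    where
    image∈′ : (suc x , y) ∈ U
    image∈′ = subst (_∈ U) (φEdge^-root-short n l′ x y (sym 2n≡)) image∈
    s+1<y : suc (suc l′ + x) < y
    s+1<y = +-cancelˡ-< l′ _ y (subst₂ _<_ (sym (+-suc l′ (suc l′ + x))) (sym 2n≡) l+s<2n)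
  ...     | inj₁ (s≤s ())
  ...     | inj₂ s<x = <-asym s<x (s≤s (m<n+m x z<s))

  -- An edge leaving the odd stretch of labels after b starts between the two given edges,
  -- which makes its span larger than s.
  odd-gap-after-maximal : ∀ {s a b t} → (∀ {e} → e ∈ U → span n e ≤ s) →
                          (1 , suc s) ∈ U → (suc a , b) ∈ U → b ≡ s + suc a →
                          b + t ≡ 2 * n → Odd t → ⊥
  odd-gap-after-maximal {s} {a} {b} {t} span≤s root∈ ab∈ refl b+t≡2n odd-t
    with odd-interval-straddled t {suc b} odd-t (s≤s z≤n) (≤-reflexive (cong suc b+t≡2n))
  ... | (u , v) , uv∈ , inj₁ (_ , _ , q≤v) = <-irrefl b+t≡2n (≤-trans q≤v (end≤2n uv∈))
  ... | (u , v) , uv∈ , inj₂ (u≤b , b<v , _)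
    with starts-outside root∈ uv∈ (≤-<-trans (m<m+n s z<s) b<v)
  ...   | inj₁ u<1 = <⇒≱ u<1 (1≤start uv∈)
  ...   | inj₂ s+1<u with starts-outside ab∈ uv∈ b<v
  ...     | inj₂ b<u = <⇒≱ b<u (s≤s⁻¹ u≤b)
  ...     | inj₁ u<a+1 = <⇒≱ (<span n s u≤v s+u<v s+v<2n+u) (span≤s uv∈)
    where
    u≤v : u ≤ v
    u≤v = <⇒≤ (≤-<-trans (s≤s⁻¹ u≤b) b<v)
    s+u<v : s + u < v
    s+u<v = <-trans (+-monoʳ-< s u<a+1) b<v
    s+v<2n+u : s + v < 2 * n + u
    s+v<2n+u = subst (s + v <_) (+-comm u (2 * n))
                 (+-mono-<-≤ (<-trans (n<1+n s) s+1<u) (end≤2n uv∈))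

  long-rotation : ∀ {l s} → Odd l → s < l → l + s < 2 * n → (∀ {e} → e ∈ U → span n e ≤ s) →
                  (1 , suc s) ∈ U → φEdge^ n l (1 , suc s) ∈ U → ⊥
  long-rotation {s = s} odd-l s<l l+s<2n span≤s root∈ image∈
    with edge-length-odd {1} {s} root∈ | m≤n⇒∃[o]m+o≡n s<l | m≤n⇒∃[o]m+o≡n l+s<2n
  ... | odd-s@(σ , refl) | t , refl | w , 2n≡ =
    odd-gap-after-maximal span≤s root∈ image∈′ refl b+t≡2n (odd-+-cancelˡ (suc-odd odd-s) odd-l)
    where
    a b : ℕ
    a = suc (s + w)
    b = s + suc a
    reorder : ∀ s t w → s + suc (suc (s + w)) + t ≡ suc (suc s + t + s) + w
    reorder = solve-∀
    b+t≡2n : b + t ≡ 2 * n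
    b+t≡2n = trans (reorder s t w) 2n≡
    image∈′ : (suc a , b) ∈ U
    image∈′ = subst (_∈ U) (φEdge^-root-long n (2 * σ) t a b (trans (sym b+t≡2n) (+-comm b t)) refl)
                (subst (λ k → φEdge^ n k (1 , suc s) ∈ U) (+-comm (suc s) t) image∈)

  odd-rotation-impossible : ∀ {l s} → Odd l → l + s < 2 * n → (∀ {e} → e ∈ U → span n e ≤ s) →
                            (1 , suc s) ∈ U → φEdge^ n l (1 , suc s) ∈ U → ⊥
  odd-rotation-impossible {l} {s} odd-l l+s<2n span≤s root∈ image∈ with l ≤? s
  ... | yes l≤s = short-rotation (odd⇒>0 odd-l) l≤s l+s<2n root∈ image∈
  ... | no  l≰s = long-rotation odd-l (≰⇒> l≰s) l+s<2n span≤s root∈ image∈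

no-odd-period : ∀ n {T l} → IsPlaneTree n T → φ^ n l T ≈ᵀ T → Odd l → l < n → ⊥
no-odd-period n {T} {l} P fix odd-l l<n
  with IsPlaneTree.covers P 1 ≤-refl (≤-trans (≤-trans (s≤s z≤n) l<n) (m≤m+n n _))
... | _ , e∈ , _ with ∃-argmax (span n) e∈
... | m , m∈ , span≤span-m with rotate-to-root n (edge-valid P m∈)
... | r , m↦root =
  odd-rotation-impossible (φ^-preserves-IsPlaneTree n r P) odd-l l+s<2n span≤s root∈ image∈
  where
  s = span n m
  U = φ^ n r T
  l+s<2n : l + s < 2 * n
  l+s<2n = subst (l + s <_) (cong (n +_) (sym (+-identityʳ n))) (+-mono-<-≤ l<n (span-≤ n m))
  root∈ : (1 , suc s) ∈ U
  root∈ = subst (_∈ U) m↦root (∈-φ^⁺ n r m∈)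
  image∈ : φEdge^ n l (1 , suc s) ∈ U
  image∈ = subst (λ e → φEdge^ n l e ∈ U) m↦root
             (subst (_∈ U) (φEdge^-comm n r l m) (∈-φ^⁺ n r (φ^-fixed⇒closed n l fix m∈)))
  span≤s : ∀ {e} → e ∈ U → span n e ≤ s
  span≤s e∈ with ∈-φ^⁻ n r e∈
  ... | e₀ , e₀∈ , refl =
    subst (_≤ s) (sym (span-φEdge^ n r (edge-valid P e₀∈))) (span≤span-m e₀∈)

lemma2 : ∀ (n : ℕ) → 1 ≤ n → ∀ (T : Tree) → IsPlaneTree n T →
         ∀ (l : ℕ) → OrbitLength n T l →
         (∃[ d ] ((1 ≤ d) × (d ∣ n) × (l ≡ 2 * d))) ⊎ ((n % 2 ≡ 1) × (l ≡ n))
lemma2 n 1≤n T P l orbit@(1≤l , fix , _)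
  with orbitLength-∣ n (2 * n) orbit (φ^-2n n P) | even-or-odd l
... | _    | inj₁ (zero , refl) with () ← 1≤l
... | l∣2n | inj₁ (suc d , refl) = inj₁ (suc d , s≤s z≤n , *-cancelˡ-∣ 2 l∣2n , refl)
... | l∣2n | inj₂ odd-l with m≤n⇒m<n∨m≡n (∣⇒≤ {{>-nonZero 1≤n}} (odd-∣-2* n odd-l l∣2n))
...   | inj₁ l<n  = ⊥-elim (no-odd-period n P fix odd-l l<n)
...   | inj₂ refl = inj₂ (odd⇒%2≡1 odd-l , refl)
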